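{- Assume $p=p(n)$ satisfies $n^{ -0.4}\le p<1$. Then with probability tending to $1$ as $n\to\infty$, $G\sim G(n,p)$ has the following property: for every perfect separating family $\mathcal{F}$ of $G$, either $|\mathcal{F}|\ge np/4$, or there is an edge $uv$ of $G$ that is not $\lfloor\sqrt{n}\rfloor$-extremal in $\mathcal{F}$.
   Context: $G(n,p)$ is the Erdős–Rényi random graph on $n$ labeled vertices where each pair is an edge independently with probability $p$. A separating family of a graph $G$ is a multiset of total orders of $V(G)$ such that for any two disjoint edges $e,f$ some member places all vertices of one edge before all vertices of the other; it is perfect with multiplicity $\lambda$ if every pair of disjoint edges is so separated by exactly $\lambda$ members (with multiplicity), $\lambda$ a positive integer. For a total order $\sigma$ of the $n$ vertices, viewed as a bijection $[n]\to V(G)$, a pair $\{u,v\}$ is $k$-extremal in $\sigma$ if $\max\{\sigma^{ -1}(u),\sigma^{ -1}(v)\}\le k$ or $\min\{\sigma^{ -1}(u),\sigma^{ -1}(v)\}\ge n-k+1$. For a perfect separating family $\mathcal{F}$ of multiplicity $\lambda$, an edge $uv$ is $k$-extremal in $\mathcal{F}$ if $\{u,v\}$ is $k$-extremal in at least $\lambda$ members of $\mathcal{F}$.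
   Formalization: The edge probability $p$ ranges over the rationals in $n^{ -0.4}\le p<1$. -}

module Defs where

open import Data.Bool using (Bool; true; false; if_then_else_; _∧_; _∨_)
open import Data.Nat as ℕ using (ℕ; zero; suc; _<ᵇ_; _≤ᵇ_)
open import Data.Nat.Combinatorics using (_C_)
open import Data.Integer using (+_)
open import Data.Fin using (Fin; toℕ)
open import Data.Fin.Permutation using (Permutation′; _⟨$⟩ˡ_)
open import Data.Vec using (Vec; lookup)
open import Data.List using (List; []; _∷_; length; map; foldr; allFin)
open import Data.List.Relation.Unary.All using (All)
open import Data.List.Relation.Unary.Unique.Propositional using (Unique)
open import Data.Rational using (ℚ; 0ℚ; 1ℚ; _+_; _*_; _-_; _/_; _≤_; _<_)
open import Relation.Binary.PropositionalEquality using (_≡_; _≢_)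
open import Relation.Nullary using (¬_)
open import Data.Product using (Σ; _×_; ∃; ∃-syntax)
open import Data.Sum using (_⊎_)

ℕtoℚ : ℕ → ℚ
ℕtoℚ m = + m / 1

_^ℚ_ : ℚ → ℕ → ℚ
x ^ℚ zero  = 1ℚ
x ^ℚ suc k = x * (x ^ℚ k)

sumℚ : List ℚ → ℚ
sumℚ = foldr _+_ 0ℚ

floorSqrt : ℕ → ℕ
floorSqrt zero = zero
floorSqrt (suc n) with floorSqrt n
... | r = if (suc r ℕ.* suc r) ≤ᵇ suc n then suc r else r

Adj : ℕ → Set
Adj n = Vec (Vec Bool n) n

adj : ∀ {n} → Adj n → Fin n → Fin n → Bool
adj G u v = lookup (lookup G u) v

Edge : ∀ {n} → Adj n → Fin n → Fin n → Set
Edge G u v = adj G u v ≡ true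

IsSimple : ∀ {n} → Adj n → Set
IsSimple {n} G = (∀ (u v : Fin n) → adj G u v ≡ adj G v u)
               × (∀ (u : Fin n) → adj G u u ≡ false)

edgeCount : ∀ {n} → Adj n → ℕ
edgeCount {n} G =
  foldr ℕ._+_ 0 (map (λ u → foldr ℕ._+_ 0
     (map (λ v → if (toℕ u <ᵇ toℕ v) ∧ adj G u v then 1 else 0) (allFin n)))
     (allFin n))

-- probability that G(n,p) equals the simple graph G:  p^e (1-p)^(C(n,2) - e)
weight : ∀ {n} → ℚ → Adj n → ℚ
weight {n} p G = (p ^ℚ edgeCount G) * ((1ℚ - p) ^ℚ ((n C 2) ℕ.∸ edgeCount G))

-- Total orders of the vertex set: σ : [n] → V a bijection
-- (σ ⟨$⟩ʳ i is the vertex in position i, 0-indexed; pos σ u = σ⁻¹(u) - 1)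

Order : ℕ → Set
Order n = Permutation′ n

pos : ∀ {n} → Order n → Fin n → ℕ
pos σ u = toℕ (σ ⟨$⟩ˡ u)

beforeB : ∀ {n} → Order n → Fin n → Fin n → Fin n → Fin n → Bool
beforeB σ a b c d = (pos σ a <ᵇ pos σ c) ∧ (pos σ a <ᵇ pos σ d)
                  ∧ (pos σ b <ᵇ pos σ c) ∧ (pos σ b <ᵇ pos σ d)

sepB : ∀ {n} → Order n → Fin n → Fin n → Fin n → Fin n → Bool
sepB σ a b c d = beforeB σ a b c d ∨ beforeB σ c d a b

-- families are multisets of orders, represented as lists
countSep : ∀ {n} → List (Order n) → Fin n → Fin n → Fin n → Fin n → ℕ
countSep []      a b c d = 0
countSep (σ ∷ F) a b c d = (if sepB σ a b c d then 1 else 0) ℕ.+ countSep F a b c d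

PerfectSep : ∀ {n} → Adj n → List (Order n) → ℕ → Set
PerfectSep {n} G F λ′ =
  (1 ℕ.≤ λ′) ×
  (∀ (a b c d : Fin n) → Edge G a b → Edge G c d →
     a ≢ c → a ≢ d → b ≢ c → b ≢ d → countSep F a b c d ≡ λ′)

-- {u,v} is k-extremal in σ (1-indexed positions pos+1):
--   max ≤ k  ⇔ both pos < k ;   min ≥ n-k+1 ⇔ both pos + k ≥ n
extremalB : ∀ {n} → ℕ → Order n → Fin n → Fin n → Bool
extremalB {n} k σ u v = ((pos σ u <ᵇ k) ∧ (pos σ v <ᵇ k))
                      ∨ ((n ≤ᵇ pos σ u ℕ.+ k) ∧ (n ≤ᵇ pos σ v ℕ.+ k))

countExt : ∀ {n} → ℕ → List (Order n) → Fin n → Fin n → ℕ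
countExt k []      u v = 0
countExt k (σ ∷ F) u v = (if extremalB k σ u v then 1 else 0) ℕ.+ countExt k F u v

ExtremalIn : ∀ {n} → ℕ → List (Order n) → ℕ → Fin n → Fin n → Set
ExtremalIn k F λ′ u v = λ′ ℕ.≤ countExt k F u v

Good : ∀ {n} → ℚ → Adj n → Set
Good {n} p G =
  ∀ (F : List (Order n)) (λ′ : ℕ) → PerfectSep G F λ′ →
    ((ℕtoℚ n * p) * (+ 1 / 4) ≤ ℕtoℚ (length F))
    ⊎ (∃[ u ] ∃[ v ] (Edge G u v × ¬ ExtremalIn (floorSqrt n) F λ′ u v))

-- "with probability ≥ q in G(n,p), the property P holds": there is a list of
-- distinct simple graphs, all satisfying P, of total G(n,p)-probability ≥ q
ProbAtLeast : (n : ℕ) → ℚ → (Adj n → Set) → ℚ → Set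
ProbAtLeast n p P q =
  Σ (List (Adj n)) λ L → Unique L × All IsSimple L × All P L × (q ≤ sumℚ (map (weight p) L))

module Submission where

-- Let k = ⌊√n⌋. A pair that is k-extremal in an order σ lies among the first k or among the
-- last k positions of σ, so σ has at most 2·C(k,2) ≤ k² ≤ n extremal pairs. If every edge of G
-- is k-extremal in F, each edge is extremal in at least λ ≥ 1 members of F, and double counting
-- gives e(G) ≤ |F|·n. So |F| ≥ np/4 whenever e(G) ≥ n²p/4.
--
-- Generating G(n,p) vertex by vertex writes e(G) as a sum of independent row degrees, so e(G)
-- has mean C(n,2)p ≈ n²p/2 and variance C(n,2)p(1−p). Chebyshev's inequality then gives
-- e(G) ≥ n²p/4 with probability at least 1 − ε as soon as εpn² ≥ 32, and p ≥ n^(−0.4) forces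
-- pn ≥ 1, hence pn² ≥ n.

open import Defs
open import Data.Nat using (ℕ)

module ExtremalCounting where

  open import Data.Bool using (Bool; true; false; if_then_else_; _∧_; _∨_; T)
  open import Data.Nat
  open import Data.Nat.Properties
  open import Data.Nat.Tactic.RingSolver using (solve-∀)
  open import Data.Empty using (⊥-elim)
  open import Data.Fin as Fin using (Fin; toℕ)
  open import Data.Fin.Permutation using (_⟨$⟩ˡ_; flip)
  open import Data.List as List using (List; []; _∷_; length; map; foldr; allFin; tabulate)
  import Data.List.Properties as List
  open import Function using (_∘_; id)
  open import Relation.Binary.PropositionalEquality
  open import Algebra.Properties.Semiring.Sum +-*-semiring
    using (sum; sum-syntax; ∑-distrib-+; ∑-permute; *-distribˡ-sum; sum-cong-≗; sum-replicate-zero)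

  𝟙 : Bool → ℕ
  𝟙 b = if b then 1 else 0

  𝟙-mono : ∀ {a b} → (T a → T b) → 𝟙 a ≤ 𝟙 b
  𝟙-mono {false} _ = z≤n
  𝟙-mono {true} {true} _ = ≤-refl
  𝟙-mono {true} {false} a⇒b = ⊥-elim (a⇒b _)

  𝟙≤1 : ∀ b → 𝟙 b ≤ 1
  𝟙≤1 false = z≤n
  𝟙≤1 true = ≤-refl

  𝟙-idem : ∀ b → 𝟙 b * 𝟙 b ≡ 𝟙 b
  𝟙-idem false = refl
  𝟙-idem true = refl

  𝟙-∧ : ∀ a b → 𝟙 (a ∧ b) ≡ 𝟙 a * 𝟙 b
  𝟙-∧ false b = refl
  𝟙-∧ true false = refl
  𝟙-∧ true true = refl

  𝟙-∨ : ∀ a b → 𝟙 (a ∨ b) ≤ 𝟙 a + 𝟙 b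
  𝟙-∨ false b = ≤-refl
  𝟙-∨ true b = s≤s z≤n

  𝟙-∨-∧ : ∀ a b c d → 𝟙 ((a ∧ b) ∨ (c ∧ d)) ≤ 𝟙 a * 𝟙 b + 𝟙 c * 𝟙 d
  𝟙-∨-∧ a b c d = ≤-trans (𝟙-∨ (a ∧ b) (c ∧ d)) (≤-reflexive (cong₂ _+_ (𝟙-∧ a b) (𝟙-∧ c d)))

  ∑-mono-≤ : ∀ {n} {f g : Fin n → ℕ} → (∀ i → f i ≤ g i) → sum f ≤ sum g
  ∑-mono-≤ {zero} _ = z≤n
  ∑-mono-≤ {suc n} f≤g = +-mono-≤ (f≤g Fin.zero) (∑-mono-≤ (f≤g ∘ Fin.suc))

  ∑-const-1 : ∀ n → ∑[ i < n ] 1 ≡ n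
  ∑-const-1 zero = refl
  ∑-const-1 (suc n) = cong suc (∑-const-1 n)

  sum-map-allFin : ∀ n (f : Fin n → ℕ) → foldr _+_ 0 (map f (allFin n)) ≡ sum f
  sum-map-allFin n f = trans (cong (foldr _+_ 0) (List.map-tabulate id f)) (sum-tabulate n f)
    where
    sum-tabulate : ∀ n (f : Fin n → ℕ) → foldr _+_ 0 (tabulate f) ≡ sum f
    sum-tabulate zero f = refl
    sum-tabulate (suc n) f = cong (f Fin.zero +_) (sum-tabulate n (f ∘ Fin.suc))

  ∑-pairs : ∀ {n} → (Fin n → Fin n → ℕ) → ℕ
  ∑-pairs {n} f = ∑[ u < n ] ∑[ v < n ] (𝟙 (toℕ u <ᵇ toℕ v) * f u v)

  ∑-pairs-mono-≤ : ∀ {n} {f g : Fin n → Fin n → ℕ} → (∀ u v → f u v ≤ g u v) → ∑-pairs f ≤ ∑-pairs g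
  ∑-pairs-mono-≤ f≤g = ∑-mono-≤ (λ u → ∑-mono-≤ (λ v → *-monoʳ-≤ (𝟙 (toℕ u <ᵇ toℕ v)) (f≤g u v)))

  ∑-pairs-cong : ∀ {n} {f g : Fin n → Fin n → ℕ} → (∀ u v → f u v ≡ g u v) → ∑-pairs f ≡ ∑-pairs g
  ∑-pairs-cong {n} f≡g =
    sum-cong-≗ {n} (λ u → sum-cong-≗ {n} (λ v → cong (𝟙 (toℕ u <ᵇ toℕ v) *_) (f≡g u v)))

  ∑-pairs-distrib-+ : ∀ {n} (f g : Fin n → Fin n → ℕ) →
    ∑-pairs (λ u v → f u v + g u v) ≡ ∑-pairs f + ∑-pairs g
  ∑-pairs-distrib-+ {n} f g = trans (sum-cong-≗ row) (∑-distrib-+ (row-sum f) (row-sum g))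
    where
    row-sum : (Fin n → Fin n → ℕ) → Fin n → ℕ
    row-sum h u = ∑[ v < n ] (𝟙 (toℕ u <ᵇ toℕ v) * h u v)
    row : ∀ u → row-sum (λ u v → f u v + g u v) u ≡ row-sum f u + row-sum g u
    row u = trans (sum-cong-≗ (λ v → *-distribˡ-+ (𝟙 (toℕ u <ᵇ toℕ v)) (f u v) (g u v)))
                  (∑-distrib-+ (λ v → 𝟙 (toℕ u <ᵇ toℕ v) * f u v) (λ v → 𝟙 (toℕ u <ᵇ toℕ v) * g u v))

  ∑-zeroʳ : ∀ {n} (f : Fin n → ℕ) → ∑[ i < n ] (f i * 0) ≡ 0
  ∑-zeroʳ {n} f = trans (sum-cong-≗ (*-zeroʳ ∘ f)) (sum-replicate-zero n)

  ∑-pairs-zero : ∀ n → ∑-pairs {n} (λ _ _ → 0) ≡ 0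
  ∑-pairs-zero n = begin
      ∑[ u < n ] ∑[ v < n ] (𝟙 (toℕ u <ᵇ toℕ v) * 0)
    ≡⟨ sum-cong-≗ {n} (λ u → ∑-zeroʳ {n} (λ v → 𝟙 (toℕ u <ᵇ toℕ v))) ⟩
      ∑[ u < n ] 0
    ≡⟨ sum-replicate-zero n ⟩
      0
    ∎
    where open ≡-Reasoning

  count : ∀ {n} → (Fin n → Bool) → ℕ
  count {n} A = ∑[ u < n ] 𝟙 (A u)

  count-mono : ∀ {n} {A B : Fin n → Bool} → (∀ u → T (A u) → T (B u)) → count A ≤ count B
  count-mono A⇒B = ∑-mono-≤ (λ u → 𝟙-mono (A⇒B u))

  count≤n : ∀ {n} (A : Fin n → Bool) → count A ≤ n
  count≤n {n} A = ≤-trans (∑-mono-≤ (λ u → 𝟙≤1 (A u))) (≤-reflexive (∑-const-1 n))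

  count-permute : ∀ {n} (A : Fin n → Bool) (σ : Order n) → count (λ u → A (σ ⟨$⟩ˡ u)) ≡ count A
  count-permute A σ = sym (∑-permute (𝟙 ∘ A) (flip σ))

  count-toℕ< : ∀ n k → count {n} (λ i → toℕ i <ᵇ k) ≤ k
  count-toℕ< n zero = ≤-reflexive (sum-replicate-zero n)
  count-toℕ< zero (suc k) = z≤n
  count-toℕ< (suc n) (suc k) = s≤s (count-toℕ< n k)

  count-≤toℕ : ∀ n t → count {n} (λ i → t ≤ᵇ toℕ i) ≤ n ∸ t
  count-≤toℕ n zero = ≤-reflexive (∑-const-1 n)
  count-≤toℕ zero (suc t) = z≤n
  count-≤toℕ (suc n) (suc t) = begin
      ∑[ i < n ] 𝟙 (suc t ≤ᵇ suc (toℕ i))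
    ≡⟨ sum-cong-≗ {n} (λ i → cong 𝟙 (suc≤ᵇsuc t (toℕ i))) ⟩
      ∑[ i < n ] 𝟙 (t ≤ᵇ toℕ i)
    ≤⟨ count-≤toℕ n t ⟩
      n ∸ t
    ∎
    where
    open ≤-Reasoning
    suc≤ᵇsuc : ∀ a b → (suc a ≤ᵇ suc b) ≡ (a ≤ᵇ b)
    suc≤ᵇsuc zero b = refl
    suc≤ᵇsuc (suc a) b = refl

  pairs : ∀ {n} → (Fin n → Bool) → ℕ
  pairs A = ∑-pairs (λ u v → 𝟙 (A u) * 𝟙 (A v))

  pairs-count : ∀ {n} (A : Fin n → Bool) → 2 * pairs A + count A ≡ count A * count A
  pairs-count {zero} A = refl
  pairs-count {suc n} A = begin
      2 * (∑[ v < n ] (1 * (a * 𝟙 (A′ v))) + pairs A′) + (a + c)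
    ≡⟨ cong (λ x → 2 * (x + pairs A′) + (a + c)) first-row ⟩
      2 * (a * c + pairs A′) + (a + c)
    ≡⟨ regroup a c (pairs A′) ⟩
      a + 2 * (a * c) + (2 * pairs A′ + c)
    ≡⟨ cong₂ (λ x y → x + 2 * (a * c) + y) (sym (𝟙-idem (A Fin.zero))) (pairs-count A′) ⟩
      a * a + 2 * (a * c) + c * c
    ≡⟨ square a c ⟩
      (a + c) * (a + c)
    ∎
    where
    open ≡-Reasoning
    A′ = A ∘ Fin.suc
    a = 𝟙 (A Fin.zero)
    c = count A′
    first-row : ∑[ v < n ] (1 * (a * 𝟙 (A′ v))) ≡ a * c
    first-row = trans (sum-cong-≗ (λ v → *-identityˡ (a * 𝟙 (A′ v)))) (sym (*-distribˡ-sum a (𝟙 ∘ A′)))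
    regroup : ∀ a c p → 2 * (a * c + p) + (a + c) ≡ a + 2 * (a * c) + (2 * p + c)
    regroup = solve-∀
    square : ∀ a c → a * a + 2 * (a * c) + c * c ≡ (a + c) * (a + c)
    square = solve-∀

  2*pairs≤count² : ∀ {n} (A : Fin n → Bool) → 2 * pairs A ≤ count A * count A
  2*pairs≤count² A = m+n≤o⇒m≤o (2 * pairs A) (≤-reflexive (pairs-count A))

  floorSqrt² : ∀ n → floorSqrt n * floorSqrt n ≤ n
  floorSqrt² zero = z≤n
  floorSqrt² (suc n) with floorSqrt n | floorSqrt² n
  ... | r | r²≤n with suc r * suc r ≤ᵇ suc n in fits
  ...   | true = ≤ᵇ⇒≤ _ _ (subst T (sym fits) _)
  ...   | false = m≤n⇒m≤1+n r²≤n

  early late : ∀ {n} → ℕ → Order n → Fin n → Bool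
  early k σ u = pos σ u <ᵇ k
  late {n} k σ u = n ≤ᵇ pos σ u + k

  count-early : ∀ {n} k (σ : Order n) → count (early k σ) ≤ k
  count-early {n} k σ = ≤-trans (≤-reflexive (count-permute {n} (λ i → toℕ i <ᵇ k) σ)) (count-toℕ< n k)

  count-late : ∀ {n} k (σ : Order n) → k ≤ n → count (late k σ) ≤ k
  count-late {n} k σ k≤n = begin
      count (late k σ)
    ≤⟨ count-mono (λ u → late⇒ (pos σ u)) ⟩
      count (λ u → n ∸ k ≤ᵇ pos σ u)
    ≡⟨ count-permute {n} (λ i → n ∸ k ≤ᵇ toℕ i) σ ⟩
      count {n} (λ i → n ∸ k ≤ᵇ toℕ i)
    ≤⟨ count-≤toℕ n (n ∸ k) ⟩
      n ∸ (n ∸ k)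
    ≡⟨ m∸[m∸n]≡n k≤n ⟩
      k
    ∎
    where
    open ≤-Reasoning
    late⇒ : ∀ i → T (n ≤ᵇ i + k) → T (n ∸ k ≤ᵇ i)
    late⇒ i n≤i+k =
      ≤⇒≤ᵇ (≤-trans (∸-monoˡ-≤ k (≤ᵇ⇒≤ n (i + k) n≤i+k)) (≤-reflexive (m+n∸n≡m i k)))

  extremalPairs : ∀ {n} → ℕ → Order n → ℕ
  extremalPairs k σ = ∑-pairs (λ u v → 𝟙 (extremalB k σ u v))

  extremalPairs≤ : ∀ {n} k (σ : Order n) → extremalPairs k σ ≤ pairs (early k σ) + pairs (late k σ)
  extremalPairs≤ {n} k σ = ≤-trans
    (∑-pairs-mono-≤ (λ u v → 𝟙-∨-∧ (early k σ u) (early k σ v) (late k σ u) (late k σ v)))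
    (≤-reflexive (∑-pairs-distrib-+ (λ u v → 𝟙 (early k σ u) * 𝟙 (early k σ v))
                                    (λ u v → 𝟙 (late k σ u) * 𝟙 (late k σ v))))

  extremalPairs-floorSqrt≤ : ∀ {n} (σ : Order n) → extremalPairs (floorSqrt n) σ ≤ n
  extremalPairs-floorSqrt≤ {n} σ = *-cancelˡ-≤ 2 (begin
      2 * extremalPairs k σ
    ≤⟨ *-monoʳ-≤ 2 (extremalPairs≤ k σ) ⟩
      2 * (pairs (early k σ) + pairs (late k σ))
    ≡⟨ *-distribˡ-+ 2 (pairs (early k σ)) _ ⟩
      2 * pairs (early k σ) + 2 * pairs (late k σ)
    ≤⟨ +-mono-≤ (2*pairs≤count² (early k σ)) (2*pairs≤count² (late k σ)) ⟩
      count (early k σ) * count (early k σ) + count (late k σ) * count (late k σ)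
    ≤⟨ +-mono-≤ (square-mono (count-early k σ)) (square-mono (count-late k σ k≤n)) ⟩
      k * k + k * k
    ≤⟨ +-mono-≤ (floorSqrt² n) (floorSqrt² n) ⟩
      n + n
    ≡⟨ cong (n +_) (sym (+-identityʳ n)) ⟩
      2 * n
    ∎)
    where
    open ≤-Reasoning
    k = floorSqrt n
    square-mono : ∀ {a b} → a ≤ b → a * a ≤ b * b
    square-mono a≤b = *-mono-≤ a≤b a≤b
    k≤n : k ≤ n
    k≤n = ≤-trans (m≤m*m k) (floorSqrt² n)
      where
      m≤m*m : ∀ m → m ≤ m * m
      m≤m*m zero = z≤n
      m≤m*m (suc m) = m≤m*n (suc m) (suc m)

  extremalIncidences : ∀ {n} → ℕ → List (Order n) → ℕ
  extremalIncidences k F = ∑-pairs (countExt k F)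

  extremalIncidences-floorSqrt≤ : ∀ {n} (F : List (Order n)) → extremalIncidences (floorSqrt n) F ≤ length F * n
  extremalIncidences-floorSqrt≤ {n} [] = ≤-reflexive (∑-pairs-zero n)
  extremalIncidences-floorSqrt≤ {n} (σ ∷ F) = ≤-trans
    (≤-reflexive (∑-pairs-distrib-+ (λ u v → 𝟙 (extremalB (floorSqrt n) σ u v)) (countExt (floorSqrt n) F)))
    (+-mono-≤ (extremalPairs-floorSqrt≤ σ) (extremalIncidences-floorSqrt≤ F))

  edgeCount≡∑-pairs : ∀ {n} (G : Adj n) → edgeCount G ≡ ∑-pairs (λ u v → 𝟙 (adj G u v))
  edgeCount≡∑-pairs {n} G = begin
      edgeCount G
    ≡⟨ cong (foldr _+_ 0) (List.map-cong (λ u → sum-map-allFin n _) (allFin n)) ⟩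
      foldr _+_ 0 (map (λ u → ∑[ v < n ] 𝟙 ((toℕ u <ᵇ toℕ v) ∧ adj G u v)) (allFin n))
    ≡⟨ sum-map-allFin n _ ⟩
      ∑[ u < n ] ∑[ v < n ] 𝟙 ((toℕ u <ᵇ toℕ v) ∧ adj G u v)
    ≡⟨ sum-cong-≗ (λ u → sum-cong-≗ (λ v → 𝟙-∧ (toℕ u <ᵇ toℕ v) (adj G u v))) ⟩
      ∑-pairs (λ u v → 𝟙 (adj G u v))
    ∎
    where open ≡-Reasoning

  edgeCount≤extremalIncidences : ∀ {n} (G : Adj n) k F λ′ → 1 ≤ λ′ →
    (∀ u v → Edge G u v → ExtremalIn k F λ′ u v) → edgeCount G ≤ extremalIncidences k F
  edgeCount≤extremalIncidences G k F λ′ 1≤λ all-extremal =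
    ≤-trans (≤-reflexive (edgeCount≡∑-pairs G)) (∑-pairs-mono-≤ edge≤extremal)
    where
    edge≤extremal : ∀ u v → 𝟙 (adj G u v) ≤ countExt k F u v
    edge≤extremal u v with adj G u v in uv
    ... | false = z≤n
    ... | true = ≤-trans 1≤λ (all-extremal u v uv)
module GraphEnumeration where

  open import Data.Bool using (Bool; true; false)
  open import Data.Nat
  open import Data.Nat.Properties
  open import Data.Nat.Combinatorics using (_C_; nC1≡n; nCk+nC[k+1]≡[n+1]C[k+1])
  open import Data.Nat.Tactic.RingSolver using (solve-∀)
  open import Data.Fin as Fin using (Fin)
  open import Data.Vec using (Vec; []; _∷_; lookup; zipWith)
  import Data.Vec.Properties as Vec
  open import Data.List as List using (List; cartesianProductWith)
  open import Data.List.Relation.Unary.All as All using (All)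
  import Data.List.Relation.Unary.All.Properties as All
  open import Data.List.Relation.Unary.Unique.Propositional using (Unique)
  import Data.List.Relation.Unary.Unique.Propositional.Properties as Unique
  import Data.List.Relation.Unary.AllPairs as AllPairs
  open import Data.Product using (_,_; _×_)
  open import Relation.Binary.PropositionalEquality
  open import Algebra.Properties.Semiring.Sum +-*-semiring using (sum-syntax; sum-cong-≗)
  open ExtremalCounting

  extend : ∀ {n} → Adj n → Vec Bool n → Adj (suc n)
  extend G r = (false ∷ r) ∷ zipWith _∷_ r G

  adj-extend-suc-suc : ∀ {n} (G : Adj n) r u v → adj (extend G r) (Fin.suc u) (Fin.suc v) ≡ adj G u v
  adj-extend-suc-suc G r u v = cong (λ row → lookup row (Fin.suc v)) (Vec.lookup-zipWith _∷_ u r G)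

  adj-extend-suc-zero : ∀ {n} (G : Adj n) r u → adj (extend G r) (Fin.suc u) Fin.zero ≡ lookup r u
  adj-extend-suc-zero G r u = cong (λ row → lookup row Fin.zero) (Vec.lookup-zipWith _∷_ u r G)

  extend-simple : ∀ {n} (G : Adj n) r → IsSimple G → IsSimple (extend G r)
  extend-simple G r (symmetric , loopless) = symmetric′ , loopless′
    where
    symmetric′ : ∀ u v → adj (extend G r) u v ≡ adj (extend G r) v u
    symmetric′ Fin.zero Fin.zero = refl
    symmetric′ Fin.zero (Fin.suc v) = sym (adj-extend-suc-zero G r v)
    symmetric′ (Fin.suc u) Fin.zero = adj-extend-suc-zero G r u
    symmetric′ (Fin.suc u) (Fin.suc v) =
      trans (adj-extend-suc-suc G r u v) (trans (symmetric u v) (sym (adj-extend-suc-suc G r v u)))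
    loopless′ : ∀ u → adj (extend G r) u u ≡ false
    loopless′ Fin.zero = refl
    loopless′ (Fin.suc u) = trans (adj-extend-suc-suc G r u u) (loopless u)

  extend-injective : ∀ {n} {G H : Adj n} {r s} → extend G r ≡ extend H s → G ≡ H × r ≡ s
  extend-injective {G = G} {H} {r} e with Vec.∷-injectiveʳ (Vec.∷-injectiveˡ e)
  ... | refl = zipWith-∷-injectiveʳ r G H (Vec.∷-injectiveʳ e) , refl
    where
    zipWith-∷-injectiveʳ : ∀ {m k} (r : Vec Bool m) (G H : Vec (Vec Bool k) m) →
      zipWith _∷_ r G ≡ zipWith _∷_ r H → G ≡ H
    zipWith-∷-injectiveʳ [] [] [] _ = refl
    zipWith-∷-injectiveʳ (b ∷ r) (x ∷ G) (y ∷ H) e =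
      cong₂ _∷_ (Vec.∷-injectiveʳ (Vec.∷-injectiveˡ e)) (zipWith-∷-injectiveʳ r G H (Vec.∷-injectiveʳ e))

  degree : ∀ {n} → Vec Bool n → ℕ
  degree r = count (lookup r)

  degree≤n : ∀ {n} (r : Vec Bool n) → degree r ≤ n
  degree≤n r = count≤n (lookup r)

  edgeCount-extend : ∀ {n} (G : Adj n) r → edgeCount (extend G r) ≡ degree r + edgeCount G
  edgeCount-extend {n} G r = begin
      edgeCount (extend G r)
    ≡⟨ edgeCount≡∑-pairs (extend G r) ⟩
      ∑[ v < n ] (1 * 𝟙 (lookup r v)) + ∑-pairs (λ u v → 𝟙 (adj (extend G r) (Fin.suc u) (Fin.suc v)))
    ≡⟨ cong₂ _+_ (sum-cong-≗ {n} (λ v → *-identityˡ (𝟙 (lookup r v))))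
                 (∑-pairs-cong (λ u v → cong 𝟙 (adj-extend-suc-suc G r u v))) ⟩
      degree r + ∑-pairs (λ u v → 𝟙 (adj G u v))
    ≡⟨ cong (degree r +_) (edgeCount≡∑-pairs G) ⟨
      degree r + edgeCount G
    ∎
    where open ≡-Reasoning

  [1+n]C2≡n+nC2 : ∀ n → suc n C 2 ≡ n + n C 2
  [1+n]C2≡n+nC2 n = trans (sym (nCk+nC[k+1]≡[n+1]C[k+1] n 1)) (cong (_+ n C 2) (nC1≡n n))

  2*nC2+n≡n*n : ∀ n → 2 * (n C 2) + n ≡ n * n
  2*nC2+n≡n*n zero = refl
  2*nC2+n≡n*n (suc n) = begin
      2 * (suc n C 2) + suc n
    ≡⟨ cong (λ c → 2 * c + suc n) ([1+n]C2≡n+nC2 n) ⟩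
      2 * (n + n C 2) + suc n
    ≡⟨ regroup n (n C 2) ⟩
      2 * n + (2 * (n C 2) + n) + 1
    ≡⟨ cong (λ m → 2 * n + m + 1) (2*nC2+n≡n*n n) ⟩
      2 * n + n * n + 1
    ≡⟨ square n ⟩
      suc n * suc n
    ∎
    where
    open ≡-Reasoning
    regroup : ∀ n c → 2 * (n + c) + suc n ≡ 2 * n + (2 * c + n) + 1
    regroup = solve-∀
    square : ∀ n → 2 * n + n * n + 1 ≡ suc n * suc n
    square = solve-∀

  edgeCount≤nC2 : ∀ {n} (G : Adj n) → edgeCount G ≤ n C 2
  edgeCount≤nC2 {n} G = *-cancelˡ-≤ 2 (+-cancelʳ-≤ n _ _ (begin
      2 * edgeCount G + n
    ≤⟨ +-monoˡ-≤ n (*-monoʳ-≤ 2 edgeCount≤pairs) ⟩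
      2 * pairs all + n
    ≡⟨ cong (2 * pairs all +_) (∑-const-1 n) ⟨
      2 * pairs all + count all
    ≡⟨ pairs-count all ⟩
      count all * count all
    ≡⟨ cong₂ _*_ (∑-const-1 n) (∑-const-1 n) ⟩
      n * n
    ≡⟨ 2*nC2+n≡n*n n ⟨
      2 * (n C 2) + n
    ∎))
    where
    open ≤-Reasoning
    all : Fin n → Bool
    all _ = true
    edgeCount≤pairs : edgeCount G ≤ pairs all
    edgeCount≤pairs = ≤-trans (≤-reflexive (edgeCount≡∑-pairs G)) (∑-pairs-mono-≤ (λ u v → 𝟙≤1 (adj G u v)))

  bits : List Bool
  bits = true List.∷ false List.∷ List.[]

  allRows : ∀ n → List (Vec Bool n)
  allRows zero = [] List.∷ List.[]
  allRows (suc n) = cartesianProductWith _∷_ bits (allRows n)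

  allGraphs : ∀ n → List (Adj n)
  allGraphs zero = [] List.∷ List.[]
  allGraphs (suc n) = cartesianProductWith extend (allGraphs n) (allRows n)

  allRows-unique : ∀ n → Unique (allRows n)
  allRows-unique zero = All.[] AllPairs.∷ AllPairs.[]
  allRows-unique (suc n) = Unique.cartesianProductWith⁺ _∷_ Vec.∷-injective bits-unique (allRows-unique n)
    where
    bits-unique : Unique bits
    bits-unique = ((λ ()) All.∷ All.[]) AllPairs.∷ (All.[] AllPairs.∷ AllPairs.[])

  allGraphs-unique : ∀ n → Unique (allGraphs n)
  allGraphs-unique zero = All.[] AllPairs.∷ AllPairs.[]
  allGraphs-unique (suc n) = Unique.cartesianProductWith⁺ extend extend-injective (allGraphs-unique n) (allRows-unique n)

  allGraphs-simple : ∀ n → All IsSimple (allGraphs n)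
  allGraphs-simple zero = ((λ ()) , (λ ())) All.∷ All.[]
  allGraphs-simple (suc n) = All.cartesianProductWith⁺ (setoid _) (setoid _) extend (allGraphs n) (allRows n)
    (λ {G} {r} G∈ _ → extend-simple G r (All.lookup (allGraphs-simple n) G∈))

open import Data.Nat as ℕ using (zero; suc)
import Data.Nat.Properties as ℕ
open import Data.Nat.Combinatorics using (_C_)
open import Data.Nat.Coprimality using (1-coprimeTo) renaming (sym to coprime-sym)
import Data.Integer as ℤ
import Data.Integer.Properties as ℤ
open import Data.Rational as ℚ using (ℚ; mkℚ; *≤*; 0ℚ; 1ℚ; _+_; _*_; _-_; -_; _/_; 1/_; _≤_; _<_)
  renaming (positive to toPositive; nonNegative to toNonNegative; nonPositive to toNonPositive)
open import Data.Rational.Properties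
open import Data.Rational.Solver
open +-*-Solver using (solve; _:+_; _:*_; _:-_; con; _:=_)
open import Data.Bool using (Bool; true; false) renaming (_≟_ to _≟ᵇ_)
open import Data.Fin.Properties using (any?)
open import Data.Vec using (Vec; []; _∷_)
open import Data.List using (List; []; _∷_; map; _++_; cartesianProductWith; filter; length)
import Data.List.Properties as List
open import Data.List.Relation.Unary.All as All using (All)
import Data.List.Relation.Unary.All.Properties as All
import Data.List.Relation.Unary.Unique.Propositional.Properties as Unique
open import Data.Product using (Σ; ∃-syntax; _,_; _×_)
open import Data.Sum using (_⊎_; inj₁; inj₂)
open import Data.Empty using (⊥-elim)
open import Function using (_∘_)
open import Relation.Nullary using (Dec; yes; no; ¬_; ¬?; _×-dec_)
open import Relation.Nullary.Decidable using (decidable-stable; toWitness)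
open import Relation.Unary using (Pred; Decidable)
open import Relation.Unary.Properties using (∁?)
open import Relation.Binary.PropositionalEquality
open ExtremalCounting using (𝟙; edgeCount≤extremalIncidences; extremalIncidences-floorSqrt≤)
open GraphEnumeration

p≤q⇒0≤q-p : ∀ {p q} → p ≤ q → 0ℚ ≤ q - p
p≤q⇒0≤q-p {p} p≤q = ≤-trans (≤-reflexive (sym (+-inverseʳ p))) (+-monoˡ-≤ (- p) p≤q)

p≤p+q : ∀ {p q} → 0ℚ ≤ q → p ≤ p + q
p≤p+q {p} 0≤q = ≤-trans (≤-reflexive (sym (+-identityʳ p))) (+-monoʳ-≤ p 0≤q)

0≤q-p⇒p≤q : ∀ {p q} → 0ℚ ≤ q - p → p ≤ q
0≤q-p⇒p≤q {p} {q} 0≤q-p = ≤-trans (p≤p+q 0≤q-p) (≤-reflexive (p+[q-p]≡q p q))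
  where
  p+[q-p]≡q : ∀ p q → p + (q - p) ≡ q
  p+[q-p]≡q = solve 2 (λ p q → p :+ (q :- p) := q) refl

*-nonNeg : ∀ {p q} → 0ℚ ≤ p → 0ℚ ≤ q → 0ℚ ≤ p * q
*-nonNeg {p} {q} 0≤p 0≤q = nonNegative⁻¹ _ {{nonNeg*nonNeg⇒nonNeg p {{toNonNegative 0≤p}} q {{toNonNegative 0≤q}}}}

*-pos : ∀ {p q} → 0ℚ < p → 0ℚ < q → 0ℚ < p * q
*-pos {p} {q} 0<p 0<q = positive⁻¹ _ {{pos*pos⇒pos p {{toPositive 0<p}} q {{toPositive 0<q}}}}

square-nonNeg : ∀ p → 0ℚ ≤ p * p
square-nonNeg p with ≤-total 0ℚ p
... | inj₁ 0≤p = *-nonNeg 0≤p 0≤p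
... | inj₂ p≤0 = nonNegative⁻¹ _ {{nonPos*nonPos⇒nonPos p {{toNonPositive p≤0}} p {{toNonPositive p≤0}}}}

*-mono-≤-nonNeg : ∀ {p q r s} → 0ℚ ≤ p → 0ℚ ≤ r → p ≤ q → r ≤ s → p * r ≤ q * s
*-mono-≤-nonNeg {p} {q} {r} {s} 0≤p 0≤r p≤q r≤s = ≤-trans
  (*-monoʳ-≤-nonNeg r {{toNonNegative 0≤r}} p≤q)
  (*-monoˡ-≤-nonNeg q {{toNonNegative (≤-trans 0≤p p≤q)}} r≤s)

0≤1 : 0ℚ ≤ 1ℚ
0≤1 = toWitness {a? = 0ℚ ℚ.≤? 1ℚ} _

ℕtoℚ≡mkℚ : ∀ m → ℕtoℚ m ≡ mkℚ (ℤ.+ m) 0 (coprime-sym (1-coprimeTo m))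
ℕtoℚ≡mkℚ m = normalize-coprime (coprime-sym (1-coprimeTo m))

ℕtoℚ-+ : ∀ m n → ℕtoℚ (m ℕ.+ n) ≡ ℕtoℚ m + ℕtoℚ n
ℕtoℚ-+ m n rewrite ℕtoℚ≡mkℚ m | ℕtoℚ≡mkℚ n
                 | ℕ.*-identityʳ m | ℕ.*-identityʳ n | ℤ.+◃n≡+n m | ℤ.+◃n≡+n n = refl

ℕtoℚ-* : ∀ m n → ℕtoℚ (m ℕ.* n) ≡ ℕtoℚ m * ℕtoℚ n
ℕtoℚ-* m n rewrite ℕtoℚ≡mkℚ m | ℕtoℚ≡mkℚ n | ℤ.+◃n≡+n (m ℕ.* n) = refl

ℕtoℚ-mono-≤ : ∀ {m n} → m ℕ.≤ n → ℕtoℚ m ≤ ℕtoℚ n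
ℕtoℚ-mono-≤ {m} {n} m≤n rewrite ℕtoℚ≡mkℚ m | ℕtoℚ≡mkℚ n =
  *≤* (ℤ.*-monoʳ-≤-nonNeg (ℤ.+ 1) (ℤ.+≤+ m≤n))

ℕtoℚ-nonNeg : ∀ n → 0ℚ ≤ ℕtoℚ n
ℕtoℚ-nonNeg n = ℕtoℚ-mono-≤ {0} {n} ℕ.z≤n

ℕtoℚ-pos : ∀ {n} → 1 ℕ.≤ n → 0ℚ < ℕtoℚ n
ℕtoℚ-pos {suc m} _ rewrite ℕtoℚ≡mkℚ (suc m) = positive⁻¹ _

ℕtoℚ-distribʳ : ∀ m n x → ℕtoℚ (m ℕ.+ n) * x ≡ ℕtoℚ m * x + ℕtoℚ n * x
ℕtoℚ-distribʳ m n x = trans (cong (_* x) (ℕtoℚ-+ m n)) (*-distribʳ-+ x (ℕtoℚ m) (ℕtoℚ n))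

^ℚ-+ : ∀ x m n → x ^ℚ (m ℕ.+ n) ≡ (x ^ℚ m) * (x ^ℚ n)
^ℚ-+ x zero n = sym (*-identityˡ _)
^ℚ-+ x (suc m) n = trans (cong (x *_) (^ℚ-+ x m n)) (sym (*-assoc x _ _))

^ℚ-distrib-* : ∀ x y n → (x * y) ^ℚ n ≡ (x ^ℚ n) * (y ^ℚ n)
^ℚ-distrib-* x y zero = refl
^ℚ-distrib-* x y (suc n) = trans (cong ((x * y) *_) (^ℚ-distrib-* x y n)) (interchange x y (x ^ℚ n) (y ^ℚ n))
  where
  interchange : ∀ a b c d → (a * b) * (c * d) ≡ (a * c) * (b * d)
  interchange = solve 4 (λ a b c d → (a :* b) :* (c :* d) := (a :* c) :* (b :* d)) refl

^ℚ-nonNeg : ∀ {x} n → 0ℚ ≤ x → 0ℚ ≤ x ^ℚ n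
^ℚ-nonNeg zero _ = 0≤1
^ℚ-nonNeg (suc n) 0≤x = *-nonNeg 0≤x (^ℚ-nonNeg n 0≤x)

1≤^ℚ : ∀ {x} k → 1ℚ ≤ x → 1ℚ ≤ x ^ℚ k
1≤^ℚ zero _ = ≤-refl
1≤^ℚ (suc k) 1≤x = *-mono-≤-nonNeg 0≤1 0≤1 1≤x (1≤^ℚ k 1≤x)

^ℚ≤1 : ∀ {x} k → 0ℚ ≤ x → x ≤ 1ℚ → x ^ℚ k ≤ 1ℚ
^ℚ≤1 zero _ _ = ≤-refl
^ℚ≤1 (suc k) 0≤x x≤1 = *-mono-≤-nonNeg 0≤x (^ℚ-nonNeg k 0≤x) x≤1 (^ℚ≤1 k 0≤x x≤1)

1≤^ℚ⇒1≤ : ∀ {x} k → 0ℚ ≤ x → 1ℚ ≤ x ^ℚ suc k → 1ℚ ≤ x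
1≤^ℚ⇒1≤ {x} k 0≤x 1≤xᵏ⁺¹ with ≤-total 1ℚ x
... | inj₁ 1≤x = 1≤x
... | inj₂ x≤1 = ≤-trans 1≤xᵏ⁺¹
  (≤-trans (*-monoˡ-≤-nonNeg x {{toNonNegative 0≤x}} (^ℚ≤1 k 0≤x x≤1)) (≤-reflexive (*-identityʳ x)))

archimedean : ∀ m ε → 0ℚ < ε → Σ ℕ λ K → ℕtoℚ m ≤ ε * ℕtoℚ K
archimedean m ε@(mkℚ ℤ.+[1+ a ] b _) _ = m ℕ.* suc b , (begin
    ℕtoℚ m
  ≡⟨ *-identityʳ (ℕtoℚ m) ⟨
    ℕtoℚ m * 1ℚ
  ≡⟨ cong (ℕtoℚ m *_) (*-inverseʳ ε) ⟨
    ℕtoℚ m * (ε * 1/ ε)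
  ≡⟨ swap (ℕtoℚ m) ε (1/ ε) ⟩
    ε * (ℕtoℚ m * 1/ ε)
  ≤⟨ *-monoˡ-≤-nonNeg ε (*-monoˡ-≤-nonNeg (ℕtoℚ m) {{toNonNegative (ℕtoℚ-nonNeg m)}} 1/ε≤1+b) ⟩
    ε * (ℕtoℚ m * ℕtoℚ (suc b))
  ≡⟨ cong (ε *_) (ℕtoℚ-* m (suc b)) ⟨
    ε * ℕtoℚ (m ℕ.* suc b)
  ∎)
  where
  open ≤-Reasoning
  swap : ∀ x y z → x * (y * z) ≡ y * (x * z)
  swap = solve 3 (λ x y z → x :* (y :* z) := y :* (x :* z)) refl
  1/ε≤1+b : 1/ ε ≤ ℕtoℚ (suc b)
  1/ε≤1+b = subst (1/ ε ≤_) (sym (ℕtoℚ≡mkℚ (suc b)))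
              (*≤* (ℤ.*-monoˡ-≤-nonNeg (ℤ.+ suc b) (ℤ.+≤+ (ℕ.s≤s ℕ.z≤n))))
archimedean m (mkℚ (ℤ.+ 0) _ _) 0<ε with toPositive 0<ε
... | ()
archimedean m (mkℚ ℤ.-[1+ _ ] _ _) 0<ε with toPositive 0<ε
... | ()

∑⟨_⟩ : ∀ {A : Set} → List A → (A → ℚ) → ℚ
∑⟨ L ⟩ f = sumℚ (map f L)

module _ {A : Set} where

  ∑-++ : ∀ (xs ys : List A) f → ∑⟨ xs ++ ys ⟩ f ≡ ∑⟨ xs ⟩ f + ∑⟨ ys ⟩ f
  ∑-++ [] ys f = sym (+-identityˡ _)
  ∑-++ (x ∷ xs) ys f = trans (cong (f x +_) (∑-++ xs ys f)) (sym (+-assoc (f x) _ _))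

  ∑-cong : ∀ (L : List A) {f g : A → ℚ} → (∀ a → f a ≡ g a) → ∑⟨ L ⟩ f ≡ ∑⟨ L ⟩ g
  ∑-cong [] f≡g = refl
  ∑-cong (x ∷ L) f≡g = cong₂ _+_ (f≡g x) (∑-cong L f≡g)

  ∑-distrib-+ : ∀ (L : List A) f g → ∑⟨ L ⟩ (λ a → f a + g a) ≡ ∑⟨ L ⟩ f + ∑⟨ L ⟩ g
  ∑-distrib-+ [] f g = refl
  ∑-distrib-+ (x ∷ L) f g = trans (cong (f x + g x +_) (∑-distrib-+ L f g)) (interchange (f x) (g x) _ _)
    where
    interchange : ∀ a b c d → (a + b) + (c + d) ≡ (a + c) + (b + d)
    interchange = solve 4 (λ a b c d → (a :+ b) :+ (c :+ d) := (a :+ c) :+ (b :+ d)) refl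

  *-distribˡ-∑ : ∀ (L : List A) c f → c * ∑⟨ L ⟩ f ≡ ∑⟨ L ⟩ (λ a → c * f a)
  *-distribˡ-∑ [] c f = *-zeroʳ c
  *-distribˡ-∑ (x ∷ L) c f = trans (*-distribˡ-+ c (f x) _) (cong (c * f x +_) (*-distribˡ-∑ L c f))

  ∑-mono-≤ : ∀ {L : List A} {f g : A → ℚ} → All (λ a → f a ≤ g a) L → ∑⟨ L ⟩ f ≤ ∑⟨ L ⟩ g
  ∑-mono-≤ All.[] = ≤-refl
  ∑-mono-≤ (fx≤gx All.∷ f≤g) = +-mono-≤ fx≤gx (∑-mono-≤ f≤g)

  ∑-nonNeg : ∀ {L : List A} {f : A → ℚ} → All (λ a → 0ℚ ≤ f a) L → 0ℚ ≤ ∑⟨ L ⟩ f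
  ∑-nonNeg All.[] = ≤-refl
  ∑-nonNeg (0≤fx All.∷ 0≤f) = +-mono-≤ 0≤fx (∑-nonNeg 0≤f)

  ∑-filter : ∀ {ℓ} {P : Pred A ℓ} (P? : Decidable P) (L : List A) f →
    ∑⟨ L ⟩ f ≡ ∑⟨ filter P? L ⟩ f + ∑⟨ filter (∁? P?) L ⟩ f
  ∑-filter P? [] f = refl
  ∑-filter P? (x ∷ L) f with P? x
  ... | yes _ = trans (cong (f x +_) (∑-filter P? L f)) (sym (+-assoc (f x) _ _))
  ... | no _ = trans (cong (f x +_) (∑-filter P? L f)) (swap (f x) (∑⟨ filter P? L ⟩ f) _)
    where
    swap : ∀ a b c → a + (b + c) ≡ b + (a + c)
    swap = solve 3 (λ a b c → a :+ (b :+ c) := b :+ (a :+ c)) refl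

  ∑-filter-≤ : ∀ {ℓ} {P : Pred A ℓ} (P? : Decidable P) {L : List A} {f : A → ℚ} →
    All (λ a → 0ℚ ≤ f a) L → ∑⟨ filter P? L ⟩ f ≤ ∑⟨ L ⟩ f
  ∑-filter-≤ P? {L} {f} 0≤f = begin
      ∑⟨ filter P? L ⟩ f
    ≤⟨ p≤p+q (∑-nonNeg (All.filter⁺ (∁? P?) 0≤f)) ⟩
      ∑⟨ filter P? L ⟩ f + ∑⟨ filter (∁? P?) L ⟩ f
    ≡⟨ ∑-filter P? L f ⟨
      ∑⟨ L ⟩ f
    ∎
    where open ≤-Reasoning

∑-map : ∀ {A B : Set} (g : A → B) (L : List A) f → ∑⟨ map g L ⟩ f ≡ ∑⟨ L ⟩ (f ∘ g)
∑-map g L f = cong sumℚ (sym (List.map-∘ L))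

∑-cartesianProductWith : ∀ {A B C : Set} (g : A → B → C) (xs : List A) (ys : List B) f →
  ∑⟨ cartesianProductWith g xs ys ⟩ f ≡ ∑⟨ xs ⟩ (λ a → ∑⟨ ys ⟩ (λ b → f (g a b)))
∑-cartesianProductWith g [] ys f = refl
∑-cartesianProductWith g (x ∷ xs) ys f = trans (∑-++ (map (g x) ys) _ f)
  (cong₂ _+_ (∑-map (g x) ys f) (∑-cartesianProductWith g xs ys f))

record Moments {A : Set} (L : List A) (w X : A → ℚ) (μ V : ℚ) : Set where
  field
    total : ∑⟨ L ⟩ w ≡ 1ℚ
    centred : ∑⟨ L ⟩ (λ a → w a * (X a - μ)) ≡ 0ℚ
    variance : ∑⟨ L ⟩ (λ a → w a * ((X a - μ) * (X a - μ))) ≡ V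

point-moments : ∀ {A : Set} (a : A) {w X : A → ℚ} → w a ≡ 1ℚ → Moments (a ∷ []) w X (X a) 0ℚ
point-moments a {w} {X} wa≡1 = record
  { total = trans (+-identityʳ (w a)) wa≡1
  ; centred = trans (+-identityʳ _) (trans (cong (w a *_) (+-inverseʳ (X a))) (*-zeroʳ (w a)))
  ; variance = trans (+-identityʳ _) (trans (cong (λ z → w a * (z * z)) (+-inverseʳ (X a))) (*-zeroʳ (w a)))
  }

module _ {A : Set} {L : List A} {w X : A → ℚ} {μ V : ℚ} (D : Moments L w X μ V) where

  open Moments D

  private
    d : A → ℚ
    d a = X a - μ

  ∑-weighted-const : ∀ x → ∑⟨ L ⟩ (λ a → w a * x) ≡ x
  ∑-weighted-const x = begin
      ∑⟨ L ⟩ (λ a → w a * x)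
    ≡⟨ ∑-cong L (λ a → *-comm (w a) x) ⟩
      ∑⟨ L ⟩ (λ a → x * w a)
    ≡⟨ *-distribˡ-∑ L x w ⟨
      x * ∑⟨ L ⟩ w
    ≡⟨ cong (x *_) total ⟩
      x * 1ℚ
    ≡⟨ *-identityʳ x ⟩
      x
    ∎
    where open ≡-Reasoning

  mean-shift : ∀ x → ∑⟨ L ⟩ (λ a → w a * (x + d a)) ≡ x
  mean-shift x = begin
      ∑⟨ L ⟩ (λ a → w a * (x + d a))
    ≡⟨ ∑-cong L (λ a → *-distribˡ-+ (w a) x (d a)) ⟩
      ∑⟨ L ⟩ (λ a → w a * x + w a * d a)
    ≡⟨ ∑-distrib-+ L (λ a → w a * x) (λ a → w a * d a) ⟩
      ∑⟨ L ⟩ (λ a → w a * x) + ∑⟨ L ⟩ (λ a → w a * d a)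
    ≡⟨ cong₂ _+_ (∑-weighted-const x) centred ⟩
      x + 0ℚ
    ≡⟨ +-identityʳ x ⟩
      x
    ∎
    where open ≡-Reasoning

  second-moment-shift : ∀ x → ∑⟨ L ⟩ (λ a → w a * ((x + d a) * (x + d a))) ≡ x * x + V
  second-moment-shift x = begin
      ∑⟨ L ⟩ (λ a → w a * ((x + d a) * (x + d a)))
    ≡⟨ ∑-cong L (λ a → expand (w a) x (d a)) ⟩
      ∑⟨ L ⟩ (λ a → w a * (x * x) + (w a * ((x + x) * d a) + w a * (d a * d a)))
    ≡⟨ ∑-distrib-+ L _ _ ⟩
      ∑⟨ L ⟩ (λ a → w a * (x * x)) + ∑⟨ L ⟩ (λ a → w a * ((x + x) * d a) + w a * (d a * d a))
    ≡⟨ cong (∑⟨ L ⟩ (λ a → w a * (x * x)) +_) (∑-distrib-+ L _ _) ⟩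
      ∑⟨ L ⟩ (λ a → w a * (x * x)) + (∑⟨ L ⟩ (λ a → w a * ((x + x) * d a)) + ∑⟨ L ⟩ (λ a → w a * (d a * d a)))
    ≡⟨ cong₂ (λ y z → y + (z + ∑⟨ L ⟩ (λ a → w a * (d a * d a)))) (∑-weighted-const (x * x)) cross-term ⟩
      x * x + (0ℚ + ∑⟨ L ⟩ (λ a → w a * (d a * d a)))
    ≡⟨ cong (λ y → x * x + y) (trans (+-identityˡ _) variance) ⟩
      x * x + V
    ∎
    where
    open ≡-Reasoning
    expand : ∀ w x d → w * ((x + d) * (x + d)) ≡ w * (x * x) + (w * ((x + x) * d) + w * (d * d))
    expand = solve 3 (λ w x d → w :* ((x :+ d) :* (x :+ d)) := w :* (x :* x) :+ (w :* ((x :+ x) :* d) :+ w :* (d :* d))) refl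
    cross-term : ∑⟨ L ⟩ (λ a → w a * ((x + x) * d a)) ≡ 0ℚ
    cross-term = begin
        ∑⟨ L ⟩ (λ a → w a * ((x + x) * d a))
      ≡⟨ ∑-cong L (λ a → swap (w a) (x + x) (d a)) ⟩
        ∑⟨ L ⟩ (λ a → (x + x) * (w a * d a))
      ≡⟨ *-distribˡ-∑ L (x + x) (λ a → w a * d a) ⟨
        (x + x) * ∑⟨ L ⟩ (λ a → w a * d a)
      ≡⟨ cong ((x + x) *_) centred ⟩
        (x + x) * 0ℚ
      ≡⟨ *-zeroʳ (x + x) ⟩
        0ℚ
      ∎
      where
      swap : ∀ a b c → a * (b * c) ≡ b * (a * c)
      swap = solve 3 (λ a b c → a :* (b :* c) := b :* (a :* c)) refl

  variance-shift : ∀ y → ∑⟨ L ⟩ (λ a → w a * (d a * d a + y)) ≡ V + y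
  variance-shift y = begin
      ∑⟨ L ⟩ (λ a → w a * (d a * d a + y))
    ≡⟨ ∑-cong L (λ a → *-distribˡ-+ (w a) (d a * d a) y) ⟩
      ∑⟨ L ⟩ (λ a → w a * (d a * d a) + w a * y)
    ≡⟨ ∑-distrib-+ L (λ a → w a * (d a * d a)) (λ a → w a * y) ⟩
      ∑⟨ L ⟩ (λ a → w a * (d a * d a)) + ∑⟨ L ⟩ (λ a → w a * y)
    ≡⟨ cong₂ _+_ variance (∑-weighted-const y) ⟩
      V + y
    ∎
    where open ≡-Reasoning
module _ {A B C : Set} {L₁ : List A} {L₂ : List B} {w₁ X₁ : A → ℚ} {w₂ X₂ : B → ℚ} {μ₁ V₁ μ₂ V₂ : ℚ}
         (D₁ : Moments L₁ w₁ X₁ μ₁ V₁) (D₂ : Moments L₂ w₂ X₂ μ₂ V₂)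
         (g : A → B → C) {w X : C → ℚ}
         (w-product : ∀ a b → w (g a b) ≡ w₁ a * w₂ b) (X-sum : ∀ a b → X (g a b) ≡ X₁ a + X₂ b) where

  private
    d₁ : A → ℚ
    d₁ a = X₁ a - μ₁
    d₂ : B → ℚ
    d₂ b = X₂ b - μ₂

    ∑-product : ∀ (h : C → ℚ) → ∑⟨ cartesianProductWith g L₁ L₂ ⟩ (λ c → w c * h c)
                    ≡ ∑⟨ L₁ ⟩ (λ a → w₁ a * ∑⟨ L₂ ⟩ (λ b → w₂ b * h (g a b)))
    ∑-product h = trans (∑-cartesianProductWith g L₁ L₂ _) (∑-cong L₁ (λ a →
      trans (∑-cong L₂ (λ b → trans (cong (_* h (g a b)) (w-product a b)) (*-assoc (w₁ a) (w₂ b) _)))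
            (sym (*-distribˡ-∑ L₂ (w₁ a) (λ b → w₂ b * h (g a b))))))

    deviation : ∀ a b → X (g a b) - (μ₁ + μ₂) ≡ d₁ a + d₂ b
    deviation a b = trans (cong (_- (μ₁ + μ₂)) (X-sum a b)) (regroup (X₁ a) (X₂ b) μ₁ μ₂)
      where
      regroup : ∀ x y m n → (x + y) - (m + n) ≡ (x - m) + (y - n)
      regroup = solve 4 (λ x y m n → (x :+ y) :- (m :+ n) := (x :- m) :+ (y :- n)) refl

  independent-sum-moments : Moments (cartesianProductWith g L₁ L₂) w X (μ₁ + μ₂) (V₁ + V₂)
  independent-sum-moments = record { total = total ; centred = centred ; variance = variance }
    where
    open ≡-Reasoning
    total : ∑⟨ cartesianProductWith g L₁ L₂ ⟩ w ≡ 1ℚ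
    total = begin
        ∑⟨ cartesianProductWith g L₁ L₂ ⟩ w
      ≡⟨ ∑-cong (cartesianProductWith g L₁ L₂) (λ c → sym (*-identityʳ (w c))) ⟩
        ∑⟨ cartesianProductWith g L₁ L₂ ⟩ (λ c → w c * 1ℚ)
      ≡⟨ ∑-product (λ _ → 1ℚ) ⟩
        ∑⟨ L₁ ⟩ (λ a → w₁ a * ∑⟨ L₂ ⟩ (λ b → w₂ b * 1ℚ))
      ≡⟨ ∑-cong L₁ (λ a → cong (w₁ a *_) (∑-weighted-const D₂ 1ℚ)) ⟩
        ∑⟨ L₁ ⟩ (λ a → w₁ a * 1ℚ)
      ≡⟨ ∑-weighted-const D₁ 1ℚ ⟩
        1ℚ
      ∎
    centred : ∑⟨ cartesianProductWith g L₁ L₂ ⟩ (λ c → w c * (X c - (μ₁ + μ₂))) ≡ 0ℚ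
    centred = begin
        ∑⟨ cartesianProductWith g L₁ L₂ ⟩ (λ c → w c * (X c - (μ₁ + μ₂)))
      ≡⟨ ∑-product (λ c → X c - (μ₁ + μ₂)) ⟩
        ∑⟨ L₁ ⟩ (λ a → w₁ a * ∑⟨ L₂ ⟩ (λ b → w₂ b * (X (g a b) - (μ₁ + μ₂))))
      ≡⟨ ∑-cong L₁ (λ a → cong (w₁ a *_) (trans (∑-cong L₂ (λ b → cong (w₂ b *_) (deviation a b)))
                                                 (mean-shift D₂ (d₁ a)))) ⟩
        ∑⟨ L₁ ⟩ (λ a → w₁ a * d₁ a)
      ≡⟨ Moments.centred D₁ ⟩
        0ℚ
      ∎
    variance : ∑⟨ cartesianProductWith g L₁ L₂ ⟩ (λ c → w c * ((X c - (μ₁ + μ₂)) * (X c - (μ₁ + μ₂)))) ≡ V₁ + V₂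
    variance = begin
        ∑⟨ cartesianProductWith g L₁ L₂ ⟩ (λ c → w c * ((X c - (μ₁ + μ₂)) * (X c - (μ₁ + μ₂))))
      ≡⟨ ∑-product (λ c → (X c - (μ₁ + μ₂)) * (X c - (μ₁ + μ₂))) ⟩
        ∑⟨ L₁ ⟩ (λ a → w₁ a * ∑⟨ L₂ ⟩ (λ b → w₂ b * ((X (g a b) - (μ₁ + μ₂)) * (X (g a b) - (μ₁ + μ₂)))))
      ≡⟨ ∑-cong L₁ (λ a → cong (w₁ a *_) (trans (∑-cong L₂ (λ b → cong (λ e → w₂ b * (e * e)) (deviation a b)))
                                                 (second-moment-shift D₂ (d₁ a)))) ⟩
        ∑⟨ L₁ ⟩ (λ a → w₁ a * (d₁ a * d₁ a + V₂))
      ≡⟨ variance-shift D₁ V₂ ⟩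
        V₁ + V₂
      ∎

chebyshev-lower : ∀ {A : Set} {L : List A} {w X : A → ℚ} {μ V : ℚ} → Moments L w X μ V →
  All (λ a → 0ℚ ≤ w a) L → ∀ {t} ε → 0ℚ < μ - t → V ≤ (μ - t) * (μ - t) * ε →
  1ℚ - ε ≤ ∑⟨ filter (λ a → t ≤? X a) L ⟩ w
chebyshev-lower {L = L} {w} {X} {μ} {V} D 0≤w {t} ε 0<gap V≤gap²ε =
  0≤q-p⇒p≤q (subst (0ℚ ≤_) margin (p≤q⇒0≤q-p bad≤ε))
  where
  good? : Decidable (λ a → t ≤ X a)
  good? a = t ≤? X a
  good bad gap² : ℚ
  good = ∑⟨ filter good? L ⟩ w
  bad = ∑⟨ filter (∁? good?) L ⟩ w
  gap² = (μ - t) * (μ - t)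
  gap²≤deviation² : ∀ a → ¬ (t ≤ X a) → gap² ≤ (X a - μ) * (X a - μ)
  gap²≤deviation² a t≰Xa = ≤-trans
    (*-mono-≤-nonNeg (<⇒≤ 0<gap) (<⇒≤ 0<gap) gap≤μ-Xa gap≤μ-Xa)
    (≤-reflexive (flip² (X a) μ))
    where
    gap≤μ-Xa : μ - t ≤ μ - X a
    gap≤μ-Xa = +-monoʳ-≤ μ (neg-antimono-≤ (<⇒≤ (≰⇒> t≰Xa)))
    flip² : ∀ x m → (m - x) * (m - x) ≡ (x - m) * (x - m)
    flip² = solve 2 (λ x m → (m :- x) :* (m :- x) := (x :- m) :* (x :- m)) refl
  bad-term : ∀ {a} → ¬ (t ≤ X a) × 0ℚ ≤ w a → gap² * w a ≤ w a * ((X a - μ) * (X a - μ))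
  bad-term {a} (t≰Xa , 0≤wa) = ≤-trans (*-monoʳ-≤-nonNeg (w a) {{toNonNegative 0≤wa}} (gap²≤deviation² a t≰Xa))
                                       (≤-reflexive (*-comm _ (w a)))
  bad*gap²≤V : bad * gap² ≤ V
  bad*gap²≤V = begin
      bad * gap²
    ≡⟨ *-comm bad gap² ⟩
      gap² * bad
    ≡⟨ *-distribˡ-∑ (filter (∁? good?) L) gap² w ⟩
      ∑⟨ filter (∁? good?) L ⟩ (λ a → gap² * w a)
    ≤⟨ ∑-mono-≤ (All.zipWith bad-term (All.all-filter (∁? good?) L , All.filter⁺ (∁? good?) 0≤w)) ⟩
      ∑⟨ filter (∁? good?) L ⟩ (λ a → w a * ((X a - μ) * (X a - μ)))
    ≤⟨ ∑-filter-≤ (∁? good?) (All.map (λ {a} 0≤wa → *-nonNeg 0≤wa (square-nonNeg (X a - μ))) 0≤w) ⟩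
      ∑⟨ L ⟩ (λ a → w a * ((X a - μ) * (X a - μ)))
    ≡⟨ Moments.variance D ⟩
      V
    ∎
    where open ≤-Reasoning
  bad≤ε : bad ≤ ε
  bad≤ε = *-cancelʳ-≤-pos gap² {{pos*pos⇒pos (μ - t) {{toPositive 0<gap}} (μ - t) {{toPositive 0<gap}}}}
    (≤-trans bad*gap²≤V (≤-trans V≤gap²ε (≤-reflexive (*-comm gap² ε))))
  margin : ε - bad ≡ good - (1ℚ - ε)
  margin = trans (sym (cancel good bad ε))
                 (cong (λ one → good - (one - ε)) (trans (sym (∑-filter good? L w)) (Moments.total D)))
    where
    cancel : ∀ g b e → g - ((g + b) - e) ≡ e - b
    cancel = solve 3 (λ g b e → g :- ((g :+ b) :- e) := e :- b) refl

module EdgeCountMoments (p : ℚ) where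

  q : ℚ
  q = 1ℚ - p

  bitWeight : Bool → ℚ
  bitWeight true = p
  bitWeight false = q

  rowWeight : ∀ {n} → Vec Bool n → ℚ
  rowWeight {n} r = (p ^ℚ degree r) * (q ^ℚ (n ℕ.∸ degree r))

  rowWeight-∷ : ∀ {n} b (r : Vec Bool n) → rowWeight (b ∷ r) ≡ bitWeight b * rowWeight r
  rowWeight-∷ true r = *-assoc p _ _
  rowWeight-∷ {n} false r = begin
      (p ^ℚ degree r) * (q ^ℚ (suc n ℕ.∸ degree r))
    ≡⟨ cong (λ k → (p ^ℚ degree r) * (q ^ℚ k)) (ℕ.+-∸-assoc 1 (degree≤n r)) ⟩
      (p ^ℚ degree r) * (q * (q ^ℚ (n ℕ.∸ degree r)))
    ≡⟨ swap (p ^ℚ degree r) q _ ⟩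
      q * rowWeight r
    ∎
    where
    open ≡-Reasoning
    swap : ∀ a b c → a * (b * c) ≡ b * (a * c)
    swap = solve 3 (λ a b c → a :* (b :* c) := b :* (a :* c)) refl

  weight-extend : ∀ {n} (G : Adj n) r → weight p (extend G r) ≡ weight p G * rowWeight r
  weight-extend {n} G r = begin
      (p ^ℚ edgeCount (extend G r)) * (q ^ℚ (suc n C 2 ℕ.∸ edgeCount (extend G r)))
    ≡⟨ cong (λ k → (p ^ℚ k) * (q ^ℚ (suc n C 2 ℕ.∸ k))) (edgeCount-extend G r) ⟩
      (p ^ℚ (d ℕ.+ e)) * (q ^ℚ (suc n C 2 ℕ.∸ (d ℕ.+ e)))
    ≡⟨ cong (λ k → (p ^ℚ (d ℕ.+ e)) * (q ^ℚ k)) non-edges ⟩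
      (p ^ℚ (d ℕ.+ e)) * (q ^ℚ ((n ℕ.∸ d) ℕ.+ (n C 2 ℕ.∸ e)))
    ≡⟨ cong₂ _*_ (^ℚ-+ p d e) (^ℚ-+ q (n ℕ.∸ d) (n C 2 ℕ.∸ e)) ⟩
      ((p ^ℚ d) * (p ^ℚ e)) * ((q ^ℚ (n ℕ.∸ d)) * (q ^ℚ (n C 2 ℕ.∸ e)))
    ≡⟨ regroup (p ^ℚ d) (p ^ℚ e) (q ^ℚ (n ℕ.∸ d)) (q ^ℚ (n C 2 ℕ.∸ e)) ⟩
      weight p G * rowWeight r
    ∎
    where
    open ≡-Reasoning
    d = degree r
    e = edgeCount G
    non-edges : suc n C 2 ℕ.∸ (d ℕ.+ e) ≡ (n ℕ.∸ d) ℕ.+ (n C 2 ℕ.∸ e)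
    non-edges = begin
        suc n C 2 ℕ.∸ (d ℕ.+ e)
      ≡⟨ cong (ℕ._∸ (d ℕ.+ e)) ([1+n]C2≡n+nC2 n) ⟩
        (n ℕ.+ n C 2) ℕ.∸ (d ℕ.+ e)
      ≡⟨ ℕ.∸-+-assoc (n ℕ.+ n C 2) d e ⟨
        (n ℕ.+ n C 2) ℕ.∸ d ℕ.∸ e
      ≡⟨ cong (ℕ._∸ e) (ℕ.+-∸-comm (n C 2) (degree≤n r)) ⟩
        ((n ℕ.∸ d) ℕ.+ n C 2) ℕ.∸ e
      ≡⟨ ℕ.+-∸-assoc (n ℕ.∸ d) (edgeCount≤nC2 G) ⟩
        (n ℕ.∸ d) ℕ.+ (n C 2 ℕ.∸ e)
      ∎
    regroup : ∀ a b c d → (a * b) * (c * d) ≡ (b * d) * (a * c)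
    regroup = solve 4 (λ a b c d → (a :* b) :* (c :* d) := (b :* d) :* (a :* c)) refl

  bit-moments : Moments bits bitWeight (ℕtoℚ ∘ 𝟙) p (p * q)
  bit-moments = record { total = total ; centred = centred ; variance = variance }
    where
    total : p + (q + 0ℚ) ≡ 1ℚ
    total = solve 1 (λ p → p :+ ((con 1ℚ :- p) :+ con 0ℚ) := con 1ℚ) refl p
    centred : p * (1ℚ - p) + (q * (0ℚ - p) + 0ℚ) ≡ 0ℚ
    centred = solve 1 (λ p → p :* (con 1ℚ :- p) :+ ((con 1ℚ :- p) :* (con 0ℚ :- p) :+ con 0ℚ) := con 0ℚ) refl p
    variance : p * ((1ℚ - p) * (1ℚ - p)) + (q * ((0ℚ - p) * (0ℚ - p)) + 0ℚ) ≡ p * q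
    variance = solve 1 (λ p → p :* ((con 1ℚ :- p) :* (con 1ℚ :- p))
                                :+ ((con 1ℚ :- p) :* ((con 0ℚ :- p) :* (con 0ℚ :- p)) :+ con 0ℚ)
                            := p :* (con 1ℚ :- p)) refl p

  row-moments : ∀ n → Moments (allRows n) rowWeight (ℕtoℚ ∘ degree) (ℕtoℚ n * p) (ℕtoℚ n * (p * q))
  row-moments zero = subst₂ (Moments (allRows 0) rowWeight (ℕtoℚ ∘ degree)) (sym (*-zeroˡ p)) (sym (*-zeroˡ (p * q)))
    (point-moments [] refl)
  row-moments (suc n) = subst₂ (Moments (allRows (suc n)) rowWeight (ℕtoℚ ∘ degree)) (one-more p) (one-more (p * q))
    (independent-sum-moments bit-moments (row-moments n) _∷_ rowWeight-∷ (λ b r → ℕtoℚ-+ (𝟙 b) (degree r)))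
    where
    one-more : ∀ x → x + ℕtoℚ n * x ≡ ℕtoℚ (suc n) * x
    one-more x = trans (cong (_+ ℕtoℚ n * x) (sym (*-identityˡ x))) (sym (ℕtoℚ-distribʳ 1 n x))

  graph-moments : ∀ n → Moments (allGraphs n) (weight p) (ℕtoℚ ∘ edgeCount)
                                (ℕtoℚ (n C 2) * p) (ℕtoℚ (n C 2) * (p * q))
  graph-moments zero = subst₂ (Moments (allGraphs 0) (weight p) (ℕtoℚ ∘ edgeCount))
    (sym (*-zeroˡ p)) (sym (*-zeroˡ (p * q))) (point-moments [] refl)
  graph-moments (suc n) = subst₂ (Moments (allGraphs (suc n)) (weight p) (ℕtoℚ ∘ edgeCount))
    (one-more p) (one-more (p * q))
    (independent-sum-moments (graph-moments n) (row-moments n) extend weight-extend edges-extend)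
    where
    edges-extend : ∀ G r → ℕtoℚ (edgeCount (extend G r)) ≡ ℕtoℚ (edgeCount G) + ℕtoℚ (degree r)
    edges-extend G r = trans (cong ℕtoℚ (trans (edgeCount-extend G r) (ℕ.+-comm (degree r) (edgeCount G))))
                             (ℕtoℚ-+ (edgeCount G) (degree r))
    one-more : ∀ x → ℕtoℚ (n C 2) * x + ℕtoℚ n * x ≡ ℕtoℚ (suc n C 2) * x
    one-more x = trans (+-comm (ℕtoℚ (n C 2) * x) (ℕtoℚ n * x))
      (sym (trans (cong (λ m → ℕtoℚ m * x) ([1+n]C2≡n+nC2 n)) (ℕtoℚ-distribʳ n (n C 2) x)))

½ ¼ ⅛ : ℚ
½ = ℤ.+ 1 / 2
¼ = ℤ.+ 1 / 4
⅛ = ℤ.+ 1 / 8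

ℕtoℚ-nC2 : ∀ n → ℕtoℚ (n C 2) ≡ ½ * (ℕtoℚ n * ℕtoℚ n - ℕtoℚ n)
ℕtoℚ-nC2 n = begin
    ℕtoℚ (n C 2)
  ≡⟨ halve (ℕtoℚ (n C 2)) (ℕtoℚ n) ⟩
    ½ * ((ℕtoℚ 2 * ℕtoℚ (n C 2) + ℕtoℚ n) - ℕtoℚ n)
  ≡⟨ cong (λ x → ½ * (x - ℕtoℚ n))
          (trans (cong (_+ ℕtoℚ n) (sym (ℕtoℚ-* 2 (n C 2)))) (sym (ℕtoℚ-+ (2 ℕ.* (n C 2)) n))) ⟩
    ½ * (ℕtoℚ (2 ℕ.* (n C 2) ℕ.+ n) - ℕtoℚ n)
  ≡⟨ cong (λ m → ½ * (ℕtoℚ m - ℕtoℚ n)) (2*nC2+n≡n*n n) ⟩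
    ½ * (ℕtoℚ (n ℕ.* n) - ℕtoℚ n)
  ≡⟨ cong (λ x → ½ * (x - ℕtoℚ n)) (ℕtoℚ-* n n) ⟩
    ½ * (ℕtoℚ n * ℕtoℚ n - ℕtoℚ n)
  ∎
  where
  open ≡-Reasoning
  halve : ∀ c N → c ≡ ½ * ((ℕtoℚ 2 * c + N) - N)
  halve = solve 2 (λ c N → c := con ½ :* ((con (ℕtoℚ 2) :* c :+ N) :- N)) refl

-- With c = C(n,2) and t = n²p/4, the gap cp − t is at least pn²/8 and the variance is at most
-- pn²/2, so Chebyshev's condition (pn²/8)²ε ≥ pn²/2 is exactly εpn² ≥ 32.
module _ {p N ε : ℚ} (0<p : 0ℚ < p) (4≤N : ℕtoℚ 4 ≤ N) (0≤ε : 0ℚ ≤ ε)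
         (32≤εpN² : ℕtoℚ 32 ≤ ε * (p * (N * N))) where

  private
    c t pN² : ℚ
    c = ½ * (N * N - N)
    t = ((N * p) * ¼) * N
    pN² = p * (N * N)
    0≤p : 0ℚ ≤ p
    0≤p = <⇒≤ 0<p
    0<N : 0ℚ < N
    0<N = <-≤-trans (toWitness {a? = 0ℚ ℚ.<? ℕtoℚ 4} _) 4≤N
    0≤N : 0ℚ ≤ N
    0≤N = <⇒≤ 0<N
    0≤½ : 0ℚ ≤ ½
    0≤½ = toWitness {a? = 0ℚ ℚ.≤? ½} _
    0<⅛ : 0ℚ < ⅛
    0<⅛ = toWitness {a? = 0ℚ ℚ.<? ⅛} _
    0≤⅛pN² : 0ℚ ≤ ⅛ * pN²
    0≤⅛pN² = *-nonNeg (<⇒≤ 0<⅛) (*-nonNeg 0≤p (square-nonNeg N))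

  gap-lower-bound : ⅛ * pN² ≤ c * p - t
  gap-lower-bound = ≤-trans (p≤p+q 0≤excess) (≤-reflexive (sym (gap≡ p N)))
    where
    0≤excess : 0ℚ ≤ ⅛ * (p * (N * (N - ℕtoℚ 4)))
    0≤excess = *-nonNeg (<⇒≤ 0<⅛) (*-nonNeg 0≤p (*-nonNeg 0≤N (p≤q⇒0≤q-p 4≤N)))
    gap≡ : ∀ p N → ½ * (N * N - N) * p - ((N * p) * ¼) * N
                   ≡ ⅛ * (p * (N * N)) + ⅛ * (p * (N * (N - ℕtoℚ 4)))
    gap≡ = solve 2 (λ p N → con ½ :* (N :* N :- N) :* p :- ((N :* p) :* con ¼) :* N
                            := con ⅛ :* (p :* (N :* N)) :+ con ⅛ :* (p :* (N :* (N :- con (ℕtoℚ 4))))) refl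

  0<gap : 0ℚ < c * p - t
  0<gap = <-≤-trans (*-pos 0<⅛ (*-pos 0<p (*-pos 0<N 0<N))) gap-lower-bound

  variance≤gap²ε : c * (p * (1ℚ - p)) ≤ (c * p - t) * (c * p - t) * ε
  variance≤gap²ε = begin
      c * (p * (1ℚ - p))
    ≤⟨ p≤p+q 0≤slack ⟩
      c * (p * (1ℚ - p)) + (½ * (p * N) + ½ * (N * (N - 1ℚ)) * (p * p))
    ≡⟨ half≡ p N ⟨
      ½ * pN²
    ≡⟨ ⅛-squared pN² ⟩
      ((⅛ * ⅛) * pN²) * ℕtoℚ 32
    ≤⟨ *-monoˡ-≤-nonNeg ((⅛ * ⅛) * pN²) {{toNonNegative 0≤⅛²pN²}} 32≤εpN² ⟩
      ((⅛ * ⅛) * pN²) * (ε * pN²)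
    ≡⟨ regroup pN² ε ⟩
      (⅛ * pN²) * (⅛ * pN²) * ε
    ≤⟨ *-monoʳ-≤-nonNeg ε {{toNonNegative 0≤ε}}
         (*-mono-≤-nonNeg 0≤⅛pN² 0≤⅛pN² gap-lower-bound gap-lower-bound) ⟩
      (c * p - t) * (c * p - t) * ε
    ∎
    where
    open ≤-Reasoning
    0≤⅛²pN² : 0ℚ ≤ (⅛ * ⅛) * pN²
    0≤⅛²pN² = *-nonNeg (square-nonNeg ⅛) (*-nonNeg 0≤p (square-nonNeg N))
    0≤slack : 0ℚ ≤ ½ * (p * N) + ½ * (N * (N - 1ℚ)) * (p * p)
    0≤slack = +-mono-≤ (*-nonNeg 0≤½ (*-nonNeg 0≤p 0≤N))
      (*-nonNeg (*-nonNeg 0≤½ (*-nonNeg 0≤N (p≤q⇒0≤q-p (≤-trans (toWitness {a? = 1ℚ ℚ.≤? ℕtoℚ 4} _) 4≤N))))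
                (square-nonNeg p))
    half≡ : ∀ p N → ½ * (p * (N * N))
                    ≡ ½ * (N * N - N) * (p * (1ℚ - p)) + (½ * (p * N) + ½ * (N * (N - 1ℚ)) * (p * p))
    half≡ = solve 2 (λ p N → con ½ :* (p :* (N :* N))
                      := con ½ :* (N :* N :- N) :* (p :* (con 1ℚ :- p))
                         :+ (con ½ :* (p :* N) :+ con ½ :* (N :* (N :- con 1ℚ)) :* (p :* p))) refl
    ⅛-squared : ∀ x → ½ * x ≡ ((⅛ * ⅛) * x) * ℕtoℚ 32
    ⅛-squared = solve 1 (λ x → con ½ :* x := ((con ⅛ :* con ⅛) :* x) :* con (ℕtoℚ 32)) refl
    regroup : ∀ x e → ((⅛ * ⅛) * x) * (e * x) ≡ (⅛ * x) * (⅛ * x) * e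
    regroup = solve 2 (λ x e → ((con ⅛ :* con ⅛) :* x) :* (e :* x) := (con ⅛ :* x) :* (con ⅛ :* x) :* e) refl

extremal-or-witness : ∀ {n} (G : Adj n) k F λ′ →
  (∀ u v → Edge G u v → ExtremalIn k F λ′ u v) ⊎ (∃[ u ] ∃[ v ] (Edge G u v × ¬ ExtremalIn k F λ′ u v))
extremal-or-witness G k F λ′
  with any? (λ u → any? (λ v → (adj G u v ≟ᵇ true) ×-dec ¬? (λ′ ℕ.≤? countExt k F u v)))
... | yes witness = inj₂ witness
... | no none = inj₁ (λ u v uv → decidable-stable (λ′ ℕ.≤? countExt k F u v) (λ ¬ext → none (u , v , uv , ¬ext)))

threshold : ℕ → ℚ → ℚ
threshold n p = ((ℕtoℚ n * p) * ¼) * ℕtoℚ n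

good-if-many-edges : ∀ {n} p (G : Adj n) → 1 ℕ.≤ n → threshold n p ≤ ℕtoℚ (edgeCount G) → Good p G
good-if-many-edges {n} p G 1≤n many F λ′ (1≤λ , _) with extremal-or-witness G (floorSqrt n) F λ′
... | inj₂ non-extremal = inj₂ non-extremal
... | inj₁ all-extremal = inj₁ (*-cancelʳ-≤-pos (ℕtoℚ n) {{toPositive (ℕtoℚ-pos 1≤n)}} (begin
    ((ℕtoℚ n * p) * ¼) * ℕtoℚ n
  ≤⟨ many ⟩
    ℕtoℚ (edgeCount G)
  ≤⟨ ℕtoℚ-mono-≤ (ℕ.≤-trans (edgeCount≤extremalIncidences G (floorSqrt n) F λ′ 1≤λ all-extremal)
                             (extremalIncidences-floorSqrt≤ F)) ⟩
    ℕtoℚ (length F ℕ.* n)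
  ≡⟨ ℕtoℚ-* (length F) n ⟩
    ℕtoℚ (length F) * ℕtoℚ n
  ∎))
  where open ≤-Reasoning

many-edges-whp : ∀ n p ε → 0ℚ < p → p < 1ℚ → 0ℚ < ε → 4 ℕ.≤ n → ℕtoℚ 32 ≤ ε * (p * (ℕtoℚ n * ℕtoℚ n)) →
  1ℚ - ε ≤ ∑⟨ filter (λ G → threshold n p ≤? ℕtoℚ (edgeCount G)) (allGraphs n) ⟩ (weight p)
many-edges-whp n p ε 0<p p<1 0<ε 4≤n 32≤εpN² =
  chebyshev-lower moments (All.universal weight-nonNeg (allGraphs n)) ε
    (0<gap 0<p 4≤N (<⇒≤ 0<ε) 32≤εpN²) (variance≤gap²ε 0<p 4≤N (<⇒≤ 0<ε) 32≤εpN²)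
  where
  open EdgeCountMoments p
  4≤N : ℕtoℚ 4 ≤ ℕtoℚ n
  4≤N = ℕtoℚ-mono-≤ 4≤n
  moments : Moments (allGraphs n) (weight p) (ℕtoℚ ∘ edgeCount)
              (½ * (ℕtoℚ n * ℕtoℚ n - ℕtoℚ n) * p) (½ * (ℕtoℚ n * ℕtoℚ n - ℕtoℚ n) * (p * q))
  moments = subst (λ c → Moments (allGraphs n) (weight p) (ℕtoℚ ∘ edgeCount) (c * p) (c * (p * q)))
                  (ℕtoℚ-nC2 n) (graph-moments n)
  weight-nonNeg : ∀ G → 0ℚ ≤ weight p G
  weight-nonNeg G = *-nonNeg (^ℚ-nonNeg (edgeCount G) (<⇒≤ 0<p))
                             (^ℚ-nonNeg (n C 2 ℕ.∸ edgeCount G) (p≤q⇒0≤q-p (<⇒≤ p<1)))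

good-whp : ∀ n p ε → 0ℚ < p → p < 1ℚ → 0ℚ < ε → 4 ℕ.≤ n → ℕtoℚ 32 ≤ ε * (p * (ℕtoℚ n * ℕtoℚ n)) →
  ProbAtLeast n p (Good p) (1ℚ - ε)
good-whp n p ε 0<p p<1 0<ε 4≤n 32≤εpN² =
  filter many? (allGraphs n) ,
  Unique.filter⁺ many? (allGraphs-unique n) ,
  All.filter⁺ many? (allGraphs-simple n) ,
  All.map (λ {G} → good-if-many-edges p G (ℕ.≤-trans (ℕ.s≤s ℕ.z≤n) 4≤n)) (All.all-filter many? (allGraphs n)) ,
  many-edges-whp n p ε 0<p p<1 0<ε 4≤n 32≤εpN²
  where
  many? : (G : Adj n) → Dec (threshold n p ≤ ℕtoℚ (edgeCount G))
  many? G = threshold n p ≤? ℕtoℚ (edgeCount G)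

1≤p⁵*m⇒0<p : ∀ p M → 0ℚ ≤ M → 1ℚ ≤ (p ^ℚ 5) * M → 0ℚ < p
1≤p⁵*m⇒0<p p M 0≤M 1≤p⁵M with p ℚ.≤? 0ℚ
... | no p≰0 = ≰⇒> p≰0
... | yes p≤0 = ⊥-elim (<-irrefl refl (<-≤-trans (toWitness {a? = 0ℚ ℚ.<? 1ℚ} _) (≤-trans 1≤p⁵M p⁵M≤0)))
  where
  p⁵≡ : p ^ℚ 5 ≡ p * ((p * p) * (p * p))
  p⁵≡ = solve 1 (λ p → p :* (p :* (p :* (p :* (p :* con 1ℚ)))) := p :* ((p :* p) :* (p :* p))) refl p
  p⁵≤0 : p ^ℚ 5 ≤ 0ℚ
  p⁵≤0 = subst (_≤ 0ℚ) (sym p⁵≡) (nonPositive⁻¹ _ {{nonPos*nonNeg⇒nonPos p {{toNonPositive p≤0}}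
           ((p * p) * (p * p)) {{toNonNegative (*-nonNeg (square-nonNeg p) (square-nonNeg p))}}}})
  p⁵M≤0 : (p ^ℚ 5) * M ≤ 0ℚ
  p⁵M≤0 = nonPositive⁻¹ _ {{nonPos*nonNeg⇒nonPos (p ^ℚ 5) {{toNonPositive p⁵≤0}} M {{toNonNegative 0≤M}}}}

1≤p⁵*x²⇒1≤p*x : ∀ {p x} → 0ℚ ≤ p → 1ℚ ≤ x → 1ℚ ≤ (p ^ℚ 5) * (x ^ℚ 2) → 1ℚ ≤ p * x
1≤p⁵*x²⇒1≤p*x {p} {x} 0≤p 1≤x 1≤p⁵x² = 1≤^ℚ⇒1≤ 4 (*-nonNeg 0≤p 0≤x) (begin
    1ℚ
  ≤⟨ *-mono-≤-nonNeg 0≤1 0≤1 1≤p⁵x² (1≤^ℚ 3 1≤x) ⟩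
    ((p ^ℚ 5) * (x ^ℚ 2)) * (x ^ℚ 3)
  ≡⟨ *-assoc (p ^ℚ 5) (x ^ℚ 2) (x ^ℚ 3) ⟩
    (p ^ℚ 5) * ((x ^ℚ 2) * (x ^ℚ 3))
  ≡⟨ cong ((p ^ℚ 5) *_) (^ℚ-+ x 2 3) ⟨
    (p ^ℚ 5) * (x ^ℚ 5)
  ≡⟨ ^ℚ-distrib-* p x 5 ⟨
    (p * x) ^ℚ 5
  ∎)
  where
  open ≤-Reasoning
  0≤x : 0ℚ ≤ x
  0≤x = ≤-trans 0≤1 1≤x

n≤p*n² : ∀ {p n} → 0ℚ ≤ p → 1 ℕ.≤ n → 1ℚ ≤ (p ^ℚ 5) * (ℕtoℚ n ^ℚ 2) →
  ℕtoℚ n ≤ p * (ℕtoℚ n * ℕtoℚ n)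
n≤p*n² {p} {n} 0≤p 1≤n 1≤p⁵n² = begin
    ℕtoℚ n
  ≡⟨ *-identityˡ (ℕtoℚ n) ⟨
    1ℚ * ℕtoℚ n
  ≤⟨ *-monoʳ-≤-nonNeg (ℕtoℚ n) {{toNonNegative (ℕtoℚ-nonNeg n)}}
       (1≤p⁵*x²⇒1≤p*x 0≤p (ℕtoℚ-mono-≤ 1≤n) 1≤p⁵n²) ⟩
    (p * ℕtoℚ n) * ℕtoℚ n
  ≡⟨ *-assoc p (ℕtoℚ n) (ℕtoℚ n) ⟩
    p * (ℕtoℚ n * ℕtoℚ n)
  ∎
  where open ≤-Reasoning

lemma10 : (ε : ℚ) → 0ℚ < ε →
    Σ ℕ λ N → (n : ℕ) → N Data.Nat.≤ n →
      (p : ℚ) → 1ℚ ≤ (p ^ℚ 5) * (ℕtoℚ n ^ℚ 2) → p < 1ℚ →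
      ProbAtLeast n p (Good p) (1ℚ - ε)
lemma10 ε 0<ε with archimedean 32 ε 0<ε
... | K , 32≤εK = K ℕ.+ 4 , whp
  where
  whp : (n : ℕ) → K ℕ.+ 4 ℕ.≤ n → (p : ℚ) → 1ℚ ≤ (p ^ℚ 5) * (ℕtoℚ n ^ℚ 2) → p < 1ℚ →
        ProbAtLeast n p (Good p) (1ℚ - ε)
  whp n K+4≤n p 1≤p⁵n² p<1 = good-whp n p ε 0<p p<1 0<ε 4≤n 32≤εpn²
    where
    4≤n : 4 ℕ.≤ n
    4≤n = ℕ.≤-trans (ℕ.m≤n+m 4 K) K+4≤n
    0<p : 0ℚ < p
    0<p = 1≤p⁵*m⇒0<p p (ℕtoℚ n ^ℚ 2) (^ℚ-nonNeg 2 (ℕtoℚ-nonNeg n)) 1≤p⁵n²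
    32≤εpn² : ℕtoℚ 32 ≤ ε * (p * (ℕtoℚ n * ℕtoℚ n))
    32≤εpn² = ≤-trans 32≤εK (*-monoˡ-≤-nonNeg ε {{toNonNegative (<⇒≤ 0<ε)}}
      (≤-trans (ℕtoℚ-mono-≤ (ℕ.≤-trans (ℕ.m≤m+n K 4) K+4≤n))
               (n≤p*n² (<⇒≤ 0<p) (ℕ.≤-trans (ℕ.s≤s ℕ.z≤n) 4≤n) 1≤p⁵n²)))
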